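{- Let $N$ and $k$ be positive integers. Every $k$-interval distinguisher of size $N$ (on inputs in $\mathbb{F}_2^m$) can be simulated by a threshold distinguisher of size at most $(2N)^{k-1}$; that is, there is a threshold distinguisher of size at most $(2N)^{k-1}$ that makes the same accept/reject decision as the given $k$-interval distinguisher on every input $w\in\mathbb{F}_2^m$.
   Context: For $H\in\mathbb{F}_2^{N\times m}$ with rows $h_1,\dots,h_N$ and $b\in\mathbb{F}_2^N$, let $A_{H,b}(w)=\sum_{i=1}^N(-1)^{\langle h_i,w\rangle+b_i}$ for $w\in\mathbb{F}_2^m$. A threshold distinguisher of size $N$ is given by such $H,b$ and a threshold $T\in\mathbb{R}$, and decides by comparing $A_{H,b}(w)$ with $T$ (accepting exactly when $A_{H,b}(w)\ge T$, or, alternatively, exactly when $A_{H,b}(w)\le T$). A $k$-interval distinguisher of size $N$ is given by such $H,b$ together with a partition of $\mathbb{R}$ into $k$ intervals, each labeled accept or reject; on input $w$ it outputs the label of the interval containing $A_{H,b}(w)$.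
   Formalization: The partition into k intervals is a partition of ℚ rather than of ℝ, and the threshold T of the simulating threshold distinguisher is taken in ℚ. -}

module Defs where

open import Data.Bool using (Bool; true; false; _xor_; _∧_; if_then_else_)
open import Data.Nat using (ℕ; suc)
open import Data.Fin using (Fin)
import Data.Fin as Fin
open import Data.Integer using (ℤ; +_; -_; _+_)
open import Data.Rational using (ℚ; _/_; _≤_)
open import Data.Vec using (Vec; []; _∷_; zipWith; foldr)
open import Data.Product using (Σ; _×_)
open import Relation.Binary.PropositionalEquality using (_≡_)

-- 𝔽₂ is Bool with xor as addition and ∧ as multiplication; 𝔽₂^m = Vec Bool m.
F2^ : ℕ → Set
F2^ m = Vec Bool m

⟨_,_⟩ : ∀ {m} → F2^ m → F2^ m → Bool
⟨ h , w ⟩ = foldr _ _xor_ false (zipWith _∧_ h w)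

sgn : Bool → ℤ
sgn false = + 1
sgn true  = - (+ 1)

-- A_{H,b}(w) = Σ_i (-1)^{⟨h_i,w⟩ + b_i}; H given by its N rows.
A : ∀ {N m} → Vec (F2^ m) N → F2^ N → F2^ m → ℤ
A []       []       w = + 0
A (h ∷ H) (bi ∷ b) w = sgn (⟨ h , w ⟩ xor bi) + A H b w

toℚ : ℤ → ℚ
toℚ z = z / 1

record ThresholdDist (m N : ℕ) : Set where
  field
    H   : Vec (F2^ m) N
    b   : F2^ N
    T   : ℚ
    geq : Bool

ThrAccepts : ∀ {m N} → ThresholdDist m N → F2^ m → Set
ThrAccepts D w with ThresholdDist.geq D
... | true  = ThresholdDist.T D ≤ toℚ (A (ThresholdDist.H D) (ThresholdDist.b D) w)
... | false = toℚ (A (ThresholdDist.H D) (ThresholdDist.b D) w) ≤ ThresholdDist.T D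

-- A partition of the (rational) line into k intervals, listed in increasing order:
-- idx x is the index of the interval containing x. The blocks idx⁻¹(i) are exactly
-- the intervals iff idx is monotone; nonemptiness of the blocks is surjectivity.
record IntervalPartition (k : ℕ) : Set where
  field
    idx       : ℚ → Fin k
    monotone  : ∀ x y → x ≤ y → idx x Fin.≤ idx y
    surjective : ∀ (i : Fin k) → Σ ℚ (λ x → idx x ≡ i)

record IntervalDist (m N k : ℕ) : Set where
  field
    H      : Vec (F2^ m) N
    b      : F2^ N
    part   : IntervalPartition k
    label  : Fin k → Bool

IntAccepts : ∀ {m N k} → IntervalDist m N k → F2^ m → Set
IntAccepts D w =
  IntervalDist.label D (IntervalPartition.idx (IntervalDist.part D)
    (toℚ (A (IntervalDist.H D) (IntervalDist.b D) w))) ≡ true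

-- Over the N rows, A(w) = N − 2q, where q ≤ N counts the rows contributing −1; call q
-- the level of w. As q grows, A(w) decreases, so the interval index of A(w) is antitone
-- in q and the decision f(q) taken on level q changes at most k − 1 times. If f changes
-- between the levels n and n + 1, the affine function A + 2n + 1 − N equals 1 + 2(n − q)
-- at level q: it is positive for q ≤ n and negative for q > n. The product of these
-- factors over all change points therefore has sign (−1)^(f(q) + f(0)) on level q. Each
-- factor is a sum of at most 2N signed characters (the N rows plus a constant), and a
-- product of sums of signed characters is again one, so the product has at most
-- (2N)^(k−1) terms and thresholding it at 0 reproduces the decision.
module Submission where

open import Defs
open import Algebra.Bundles using (CommutativeRing)
open import Data.Bool using (Bool; true; false; _xor_; _∧_; if_then_else_)
open import Data.Bool.Properties
  using (xor-same; xor-assoc; xor-identityʳ; not-involutive; ∧-identityʳ; ∧-zeroʳ;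
         ∧-distribʳ-xor; xor-∧-commutativeRing)
open import Algebra.Properties.CommutativeSemigroup
  (CommutativeRing.+-commutativeSemigroup xor-∧-commutativeRing)
  renaming (interchange to xor-interchange)
open import Data.Fin using (Fin; toℕ)
import Data.Fin as Fin
import Data.Fin.Properties as FinP
open import Data.Integer as ℤ using (ℤ; +_; +[1+_]; -[1+_]; 0ℤ)
import Data.Integer.Properties as ℤP
open import Data.Integer.Tactic.RingSolver using (solve-∀)
open import Data.List using (List; []; _∷_; _++_; [_]; map; length; replicate; cartesianProductWith)
open import Data.List.Properties using (length-++; length-map; length-replicate)
open import Data.Nat using (ℕ; zero; suc; _+_; _*_; _^_; _∸_; _⊓_; _≤_; _<_; _<?_; z≤n; s≤s)
import Data.Nat.Properties as ℕP
import Data.Nat.Coprimality as Coprimality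
open import Data.Product using (Σ; _×_; _,_; proj₁; proj₂)
open import Data.Rational as ℚ using (mkℚ; *≤*)
open import Data.Rational.Properties using (↥p/↧p≡p)
open import Data.Vec using (Vec; []; _∷_; zip; unzip; toList; fromList)
import Data.Vec as Vec
open import Data.Vec.Properties using (length-toList)
open import Function using (_∘_)
open import Function.Bundles using (_⇔_; mk⇔)
open import Relation.Nullary using (yes; no; contradiction)
open import Relation.Nullary.Decidable using (⌊_⌋)
open import Relation.Binary.PropositionalEquality
  using (_≡_; refl; sym; trans; cong; cong₂; subst; subst₂; module ≡-Reasoning)

_⊕_ : ∀ {m} → F2^ m → F2^ m → F2^ m
_⊕_ = Vec.zipWith _xor_

⟨⟩-distribʳ-⊕ : ∀ {m} (h h′ w : F2^ m) → ⟨ h ⊕ h′ , w ⟩ ≡ ⟨ h , w ⟩ xor ⟨ h′ , w ⟩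
⟨⟩-distribʳ-⊕ []      []        []      = refl
⟨⟩-distribʳ-⊕ (a ∷ h) (a′ ∷ h′) (x ∷ w) = begin
  ((a xor a′) ∧ x) xor ⟨ h ⊕ h′ , w ⟩
    ≡⟨ cong₂ _xor_ (∧-distribʳ-xor x a a′) (⟨⟩-distribʳ-⊕ h h′ w) ⟩
  ((a ∧ x) xor (a′ ∧ x)) xor (⟨ h , w ⟩ xor ⟨ h′ , w ⟩)
    ≡⟨ xor-interchange (a ∧ x) (a′ ∧ x) ⟨ h , w ⟩ ⟨ h′ , w ⟩ ⟩
  ((a ∧ x) xor ⟨ h , w ⟩) xor ((a′ ∧ x) xor ⟨ h′ , w ⟩) ∎
  where open ≡-Reasoning

⟨0,w⟩≡false : ∀ {m} (w : F2^ m) → ⟨ Vec.replicate m false , w ⟩ ≡ false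
⟨0,w⟩≡false []      = refl
⟨0,w⟩≡false (x ∷ w) = ⟨0,w⟩≡false w

sgn-xor : ∀ x y → sgn (x xor y) ≡ sgn x ℤ.* sgn y
sgn-xor false false = refl
sgn-xor false true  = refl
sgn-xor true  false = refl
sgn-xor true  true  = refl

Character : ℕ → Set
Character m = F2^ m × Bool

χ : ∀ {m} → Character m → F2^ m → ℤ
χ (h , s) w = sgn (⟨ h , w ⟩ xor s)

_·_ : ∀ {m} → Character m → Character m → Character m
(h , s) · (h′ , s′) = h ⊕ h′ , s xor s′

χ-· : ∀ {m} (c d : Character m) w → χ (c · d) w ≡ χ c w ℤ.* χ d w
χ-· (h , s) (h′ , s′) w = begin
  sgn (⟨ h ⊕ h′ , w ⟩ xor (s xor s′))
    ≡⟨ cong (λ x → sgn (x xor (s xor s′))) (⟨⟩-distribʳ-⊕ h h′ w) ⟩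
  sgn ((⟨ h , w ⟩ xor ⟨ h′ , w ⟩) xor (s xor s′))
    ≡⟨ cong sgn (xor-interchange ⟨ h , w ⟩ ⟨ h′ , w ⟩ s s′) ⟩
  sgn ((⟨ h , w ⟩ xor s) xor (⟨ h′ , w ⟩ xor s′))
    ≡⟨ sgn-xor (⟨ h , w ⟩ xor s) (⟨ h′ , w ⟩ xor s′) ⟩
  χ (h , s) w ℤ.* χ (h′ , s′) w ∎
  where open ≡-Reasoning

constant : ∀ {m} → Bool → Character m
constant s = Vec.replicate _ false , s

χ-constant : ∀ {m} s (w : F2^ m) → χ (constant s) w ≡ sgn s
χ-constant s w = cong (λ x → sgn (x xor s)) (⟨0,w⟩≡false w)

CharSum : ℕ → Set
CharSum m = List (Character m)

⟦_⟧ : ∀ {m} → CharSum m → F2^ m → ℤ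
⟦ []    ⟧ w = 0ℤ
⟦ c ∷ L ⟧ w = χ c w ℤ.+ ⟦ L ⟧ w

⟦⟧-++ : ∀ {m} (L M : CharSum m) w → ⟦ L ++ M ⟧ w ≡ ⟦ L ⟧ w ℤ.+ ⟦ M ⟧ w
⟦⟧-++ []      M w = sym (ℤP.+-identityˡ (⟦ M ⟧ w))
⟦⟧-++ (c ∷ L) M w = trans (cong (ℤ._+_ (χ c w)) (⟦⟧-++ L M w))
                          (sym (ℤP.+-assoc (χ c w) (⟦ L ⟧ w) (⟦ M ⟧ w)))

⟦⟧-replicate : ∀ {m} n (c : Character m) w → ⟦ replicate n c ⟧ w ≡ + n ℤ.* χ c w
⟦⟧-replicate zero    c w = refl
⟦⟧-replicate (suc n) c w =
  trans (cong (ℤ._+_ (χ c w)) (⟦⟧-replicate n c w)) (sym (ℤP.suc-* (+ n) (χ c w)))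

⟦⟧-map-· : ∀ {m} (c : Character m) M w → ⟦ map (c ·_) M ⟧ w ≡ χ c w ℤ.* ⟦ M ⟧ w
⟦⟧-map-· c []      w = sym (ℤP.*-zeroʳ (χ c w))
⟦⟧-map-· c (d ∷ M) w = trans (cong₂ ℤ._+_ (χ-· c d w) (⟦⟧-map-· c M w))
                             (sym (ℤP.*-distribˡ-+ (χ c w) (χ d w) (⟦ M ⟧ w)))

_⊛_ : ∀ {m} → CharSum m → CharSum m → CharSum m
_⊛_ = cartesianProductWith _·_

⟦⟧-⊛ : ∀ {m} (L M : CharSum m) w → ⟦ L ⊛ M ⟧ w ≡ ⟦ L ⟧ w ℤ.* ⟦ M ⟧ w
⟦⟧-⊛ []      M w = refl
⟦⟧-⊛ (c ∷ L) M w = begin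
  ⟦ map (c ·_) M ++ L ⊛ M ⟧ w            ≡⟨ ⟦⟧-++ (map (c ·_) M) (L ⊛ M) w ⟩
  ⟦ map (c ·_) M ⟧ w ℤ.+ ⟦ L ⊛ M ⟧ w     ≡⟨ cong₂ ℤ._+_ (⟦⟧-map-· c M w) (⟦⟧-⊛ L M w) ⟩
  χ c w ℤ.* ⟦ M ⟧ w ℤ.+ ⟦ L ⟧ w ℤ.* ⟦ M ⟧ w ≡⟨ ℤP.*-distribʳ-+ (⟦ M ⟧ w) (χ c w) (⟦ L ⟧ w) ⟨
  (χ c w ℤ.+ ⟦ L ⟧ w) ℤ.* ⟦ M ⟧ w         ∎
  where open ≡-Reasoning

length-⊛ : ∀ {m} (L M : CharSum m) → length (L ⊛ M) ≡ length L * length M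
length-⊛ []      M = refl
length-⊛ (c ∷ L) M = trans (length-++ (map (c ·_) M))
                           (cong₂ _+_ (length-map (c ·_) M) (length-⊛ L M))

offset : ∀ {m} → ℕ → ℕ → CharSum m
offset p n = replicate p (constant false) ++ replicate n (constant true)

⟦offset⟧ : ∀ {m} p n (w : F2^ m) → ⟦ offset p n ⟧ w ≡ + p ℤ.- + n
⟦offset⟧ p n w = begin
  ⟦ offset p n ⟧ w
    ≡⟨ ⟦⟧-++ (replicate p (constant false)) (replicate n (constant true)) w ⟩
  ⟦ replicate p (constant false) ⟧ w ℤ.+ ⟦ replicate n (constant true) ⟧ w
    ≡⟨ cong₂ ℤ._+_ (⟦⟧-replicate p (constant false) w) (⟦⟧-replicate n (constant true) w) ⟩
  + p ℤ.* χ (constant false) w ℤ.+ + n ℤ.* χ (constant true) w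
    ≡⟨ cong₂ (λ x y → + p ℤ.* x ℤ.+ + n ℤ.* y) (χ-constant false w) (χ-constant true w) ⟩
  + p ℤ.* ℤ.1ℤ ℤ.+ + n ℤ.* ℤ.-1ℤ
    ≡⟨ cong₂ ℤ._+_ (ℤP.*-identityʳ (+ p)) (trans (ℤP.*-comm (+ n) ℤ.-1ℤ) (ℤP.-1*i≡-i (+ n))) ⟩
  + p ℤ.- + n ∎
  where open ≡-Reasoning

length-offset : ∀ {m} p n → length (offset {m} p n) ≡ p + n
length-offset p n = trans (length-++ (replicate p (constant false)))
                          (cong₂ _+_ (length-replicate p) (length-replicate n))

rowSum : ∀ {m N} → Vec (F2^ m) N → F2^ N → CharSum m
rowSum H b = toList (zip H b)

⟦rowSum⟧ : ∀ {m N} (H : Vec (F2^ m) N) b w → ⟦ rowSum H b ⟧ w ≡ A H b w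
⟦rowSum⟧ []      []      w = refl
⟦rowSum⟧ (h ∷ H) (s ∷ b) w = cong (ℤ._+_ (χ (h , s) w)) (⟦rowSum⟧ H b w)

length-rowSum : ∀ {m N} (H : Vec (F2^ m) N) b → length (rowSum H b) ≡ N
length-rowSum H b = length-toList (zip H b)

matrix : ∀ {m} (L : CharSum m) → Vec (F2^ m) (length L)
matrix L = proj₁ (unzip (fromList L))

bias : ∀ {m} (L : CharSum m) → F2^ (length L)
bias L = proj₂ (unzip (fromList L))

A-matrix : ∀ {m} (L : CharSum m) w → A (matrix L) (bias L) w ≡ ⟦ L ⟧ w
A-matrix []      w = refl
A-matrix (c ∷ L) w = cong (ℤ._+_ (χ c w)) (A-matrix L w)

level : ℕ → ℕ → ℤ
level N q = + N ℤ.- (+ q ℤ.+ + q)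

A-level : ∀ {m N} (H : Vec (F2^ m) N) b w → Σ ℕ λ q → q ≤ N × A H b w ≡ level N q
A-level []      []      w = 0 , z≤n , refl
A-level {N = suc N} (h ∷ H) (s ∷ b) w with A-level H b w | ⟨ h , w ⟩ xor s
... | q , q≤N , eq | false =
  q , ℕP.m≤n⇒m≤1+n q≤N , trans (cong (ℤ._+_ (+ 1)) eq) (level-up (+ N) (+ q))
  where
    level-up : ∀ n q → + 1 ℤ.+ (n ℤ.- (q ℤ.+ q)) ≡ (+ 1 ℤ.+ n) ℤ.- (q ℤ.+ q)
    level-up = solve-∀
... | q , q≤N , eq | true =
  suc q , s≤s q≤N , trans (cong (ℤ._+_ ℤ.-1ℤ) eq) (level-up (+ N) (+ q))
  where
    level-up : ∀ n q → ℤ.- + 1 ℤ.+ (n ℤ.- (q ℤ.+ q))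
                     ≡ (+ 1 ℤ.+ n) ℤ.- ((+ 1 ℤ.+ q) ℤ.+ (+ 1 ℤ.+ q))
    level-up = solve-∀

level-antitone : ∀ N q → level N (suc q) ℤ.≤ level N q
level-antitone N q =
  subst (level N (suc q) ℤ.≤_) (level-shift (+ N) (+ q)) (ℤP.i≤i+j (level N (suc q)) (+ 2))
  where
    level-shift : ∀ n q → n ℤ.- ((+ 1 ℤ.+ q) ℤ.+ (+ 1 ℤ.+ q)) ℤ.+ + 2 ≡ n ℤ.- (q ℤ.+ q)
    level-shift = solve-∀

toℚ≡mkℚ : ∀ i → toℚ i ≡ mkℚ i 0 (Coprimality.sym (Coprimality.1-coprimeTo ℤ.∣ i ∣))
toℚ≡mkℚ i = ↥p/↧p≡p (mkℚ i 0 (Coprimality.sym (Coprimality.1-coprimeTo ℤ.∣ i ∣)))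

toℚ-mono-≤ : ∀ {i j} → i ℤ.≤ j → toℚ i ℚ.≤ toℚ j
toℚ-mono-≤ {i} {j} i≤j = subst₂ ℚ._≤_ (sym (toℚ≡mkℚ i)) (sym (toℚ≡mkℚ j))
  (*≤* (subst₂ ℤ._≤_ (sym (ℤP.*-identityʳ i)) (sym (ℤP.*-identityʳ j)) i≤j))

toℚ-cancel-≤ : ∀ {i j} → toℚ i ℚ.≤ toℚ j → i ℤ.≤ j
toℚ-cancel-≤ {i} {j} p with subst₂ ℚ._≤_ (toℚ≡mkℚ i) (toℚ≡mkℚ j) p
... | *≤* i≤j = subst₂ ℤ._≤_ (ℤP.*-identityʳ i) (ℤP.*-identityʳ j) i≤j

data HasSign : ℤ → Bool → Set where
  positive : ∀ n → HasSign +[1+ n ] false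
  negative : ∀ n → HasSign -[1+ n ] true

HasSign-* : ∀ {i j s t} → HasSign i s → HasSign j t → HasSign (i ℤ.* j) (s xor t)
HasSign-* (positive m) (positive n) = positive _
HasSign-* (positive m) (negative n) = negative _
HasSign-* (negative m) (positive n) = negative _
HasSign-* (negative m) (negative n) = positive _

HasSign-odd : ∀ n q → HasSign (+ 1 ℤ.+ ((+ n ℤ.+ + n) ℤ.- (+ q ℤ.+ + q))) ⌊ n <? q ⌋
HasSign-odd n q with n <? q
... | yes n<q with ℕP.m≤n⇒∃[o]m+o≡n n<q
...   | d , refl = subst (λ i → HasSign i true) (sym (odd-below (+ n) (+ d))) (negative (d + d))
  where
    odd-below : ∀ n d → + 1 ℤ.+ ((n ℤ.+ n) ℤ.- ((+ 1 ℤ.+ n ℤ.+ d) ℤ.+ (+ 1 ℤ.+ n ℤ.+ d)))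
                      ≡ ℤ.- (+ 1 ℤ.+ (d ℤ.+ d))
    odd-below = solve-∀
HasSign-odd n q | no n≮q with ℕP.m≤n⇒∃[o]m+o≡n (ℕP.≮⇒≥ n≮q)
...   | d , refl = subst (λ i → HasSign i false) (sym (odd-above (+ q) (+ d))) (positive (d + d))
  where
    odd-above : ∀ q d → + 1 ℤ.+ (((q ℤ.+ d) ℤ.+ (q ℤ.+ d)) ℤ.- (q ℤ.+ q)) ≡ + 1 ℤ.+ (d ℤ.+ d)
    odd-above = solve-∀

nonNegative⇔ : ∀ {i} a → HasSign i (true xor a) → toℚ 0ℤ ℚ.≤ toℚ i ⇔ a ≡ true
nonNegative⇔ true  (positive n) =
  mk⇔ (λ _ → refl) (λ _ → toℚ-mono-≤ {0ℤ} {+[1+ n ]} (ℤ.+≤+ z≤n))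
nonNegative⇔ false (negative n) =
  mk⇔ (λ 0≤i → contradiction (toℚ-cancel-≤ {0ℤ} { -[1+ n ]} 0≤i) λ ()) λ ()

nonPositive⇔ : ∀ {i} a → HasSign i (false xor a) → toℚ i ℚ.≤ toℚ 0ℤ ⇔ a ≡ true
nonPositive⇔ true  (negative n) =
  mk⇔ (λ _ → refl) (λ _ → toℚ-mono-≤ { -[1+ n ]} {0ℤ} ℤ.-≤+)
nonPositive⇔ false (positive n) =
  mk⇔ (λ i≤0 → contradiction (toℚ-cancel-≤ {+[1+ n ]} {0ℤ} i≤0) λ { (ℤ.+≤+ ()) }) λ ()

thresholdAtZero : ∀ {m} (L : CharSum m) → Bool → ThresholdDist m (length L)
thresholdAtZero L geq = record { H = matrix L ; b = bias L ; T = toℚ 0ℤ ; geq = geq }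

thresholdAtZero-accepts : ∀ {m} (L : CharSum m) geq w a →
  HasSign (⟦ L ⟧ w) (geq xor a) → ThrAccepts (thresholdAtZero L geq) w ⇔ a ≡ true
thresholdAtZero-accepts L true w a s =
  subst (λ i → toℚ 0ℤ ℚ.≤ toℚ i ⇔ a ≡ true) (sym (A-matrix L w)) (nonNegative⇔ a s)
thresholdAtZero-accepts L false w a s =
  subst (λ i → toℚ i ℚ.≤ toℚ 0ℤ ⇔ a ≡ true) (sym (A-matrix L w)) (nonPositive⇔ a s)

changes : (ℕ → Bool) → ℕ → ℕ
changes f zero    = 0
changes f (suc n) = if f n xor f (suc n) then suc (changes f n) else changes f n

changes-descent : ∀ {k} (ι : ℕ → Fin k) (g : Fin k → Bool) → (∀ n → ι (suc n) Fin.≤ ι n) →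
  ∀ n → changes (g ∘ ι) n + toℕ (ι n) ≤ toℕ (ι 0)
changes-descent ι g antitone zero = ℕP.≤-refl
changes-descent ι g antitone (suc n) with g (ι n) xor g (ι (suc n)) in flipped
... | false = ℕP.≤-trans (ℕP.+-monoʳ-≤ (changes (g ∘ ι) n) (antitone n))
                         (changes-descent ι g antitone n)
... | true  = begin
  suc (changes (g ∘ ι) n + toℕ (ι (suc n))) ≡⟨ ℕP.+-suc (changes (g ∘ ι) n) (toℕ (ι (suc n))) ⟨
  changes (g ∘ ι) n + suc (toℕ (ι (suc n))) ≤⟨ ℕP.+-monoʳ-≤ (changes (g ∘ ι) n) descends ⟩
  changes (g ∘ ι) n + toℕ (ι n)             ≤⟨ changes-descent ι g antitone n ⟩
  toℕ (ι 0)                                 ∎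
  where
    open ℕP.≤-Reasoning
    descends : toℕ (ι (suc n)) < toℕ (ι n)
    descends = ℕP.≤∧≢⇒< (antitone n) λ same → contradiction
      (trans (sym flipped) (trans (cong (λ i → g (ι n) xor g i) (FinP.toℕ-injective same))
                                  (xor-same (g (ι n)))))
      λ ()

changes-≤ : ∀ {k} (ι : ℕ → Fin k) (g : Fin k → Bool) → (∀ n → ι (suc n) Fin.≤ ι n) →
  ∀ n → changes (g ∘ ι) n ≤ k ∸ 1
changes-≤ ι g antitone n =
  ℕP.≤-trans (ℕP.m≤m+n (changes (g ∘ ι) n) (toℕ (ι n)))
    (ℕP.≤-trans (changes-descent ι g antitone n) (FinP.toℕ≤pred[n] (ι 0)))

xor-cancelˡ : ∀ a b → a xor (a xor b) ≡ b
xor-cancelˡ false b = refl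
xor-cancelˡ true  b = not-involutive b

⊓-step : ∀ (f : ℕ → Bool) n q →
  f (suc n ⊓ q) ≡ f (n ⊓ q) xor ((f n xor f (suc n)) ∧ ⌊ n <? q ⌋)
⊓-step f n q with n <? q
... | yes n<q rewrite ℕP.m≤n⇒m⊓n≡m n<q | ℕP.m≤n⇒m⊓n≡m (ℕP.<⇒≤ n<q) =
  sym (trans (cong (f n xor_) (∧-identityʳ (f n xor f (suc n)))) (xor-cancelˡ (f n) (f (suc n))))
... | no n≮q rewrite ℕP.m≥n⇒m⊓n≡n (ℕP.≮⇒≥ n≮q) | ℕP.m≥n⇒m⊓n≡n (ℕP.m≤n⇒m≤1+n (ℕP.≮⇒≥ n≮q)) =
  sym (trans (cong (f q xor_) (∧-zeroʳ (f n xor f (suc n)))) (xor-identityʳ (f q)))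

module SignInterpolation {m N} (H : Vec (F2^ m) N) (b : F2^ N) (f : ℕ → Bool) where

  factor : ℕ → CharSum m
  factor n = rowSum H b ++ offset n (N ∸ suc n)

  product : ℕ → CharSum m
  product zero    = [ constant false ]
  product (suc n) = if f n xor f (suc n) then product n ⊛ factor n else product n

  length-factor : ∀ n → n < N → length (factor n) ≤ 2 * N
  length-factor n n<N = begin
    length (rowSum H b ++ offset n (N ∸ suc n))
      ≡⟨ length-++ (rowSum H b) ⟩
    length (rowSum H b) + length (offset {m} n (N ∸ suc n))
      ≡⟨ cong₂ _+_ (length-rowSum H b) (length-offset n (N ∸ suc n)) ⟩
    N + (n + (N ∸ suc n))
      ≤⟨ ℕP.+-monoʳ-≤ N (ℕP.≤-trans (ℕP.n≤1+n _) (ℕP.≤-reflexive (ℕP.m+[n∸m]≡n n<N))) ⟩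
    N + N
      ≡⟨ cong (_+_ N) (ℕP.+-identityʳ N) ⟨
    2 * N ∎
    where open ℕP.≤-Reasoning

  length-product : ∀ n → n ≤ N → length (product n) ≤ (2 * N) ^ changes f n
  length-product zero    _    = ℕP.≤-refl
  length-product (suc n) n<N with f n xor f (suc n)
  ... | false = length-product n (ℕP.<⇒≤ n<N)
  ... | true  = begin
    length (product n ⊛ factor n)            ≡⟨ length-⊛ (product n) (factor n) ⟩
    length (product n) * length (factor n)
      ≤⟨ ℕP.*-mono-≤ (length-product n (ℕP.<⇒≤ n<N)) (length-factor n n<N) ⟩
    (2 * N) ^ changes f n * (2 * N)          ≡⟨ ℕP.*-comm ((2 * N) ^ changes f n) (2 * N) ⟩
    (2 * N) ^ suc (changes f n)              ∎
    where open ℕP.≤-Reasoning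

  module _ {w q} (A≡level : A H b w ≡ level N q) where

    ⟦factor⟧ : ∀ n → n < N → ⟦ factor n ⟧ w ≡ + 1 ℤ.+ ((+ n ℤ.+ + n) ℤ.- (+ q ℤ.+ + q))
    ⟦factor⟧ n n<N = begin
      ⟦ rowSum H b ++ offset n (N ∸ suc n) ⟧ w
        ≡⟨ ⟦⟧-++ (rowSum H b) (offset n (N ∸ suc n)) w ⟩
      ⟦ rowSum H b ⟧ w ℤ.+ ⟦ offset n (N ∸ suc n) ⟧ w
        ≡⟨ cong₂ ℤ._+_ (trans (⟦rowSum⟧ H b w) A≡level) (⟦offset⟧ n (N ∸ suc n) w) ⟩
      level N q ℤ.+ (+ n ℤ.- + (N ∸ suc n))
        ≡⟨ cong (λ i → level N q ℤ.+ (+ n ℤ.- i)) gap ⟩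
      level N q ℤ.+ (+ n ℤ.- (+ N ℤ.- + suc n))
        ≡⟨ odd-value (+ N) (+ n) (+ q) ⟩
      + 1 ℤ.+ ((+ n ℤ.+ + n) ℤ.- (+ q ℤ.+ + q)) ∎
      where
        open ≡-Reasoning
        gap : + (N ∸ suc n) ≡ + N ℤ.- + suc n
        gap = sym (trans (ℤP.m-n≡m⊖n N (suc n)) (ℤP.⊖-≥ n<N))
        odd-value : ∀ N n q → (N ℤ.- (q ℤ.+ q)) ℤ.+ (n ℤ.- (N ℤ.- (+ 1 ℤ.+ n)))
                            ≡ + 1 ℤ.+ ((n ℤ.+ n) ℤ.- (q ℤ.+ q))
        odd-value = solve-∀

    sign-factor : ∀ n → n < N → HasSign (⟦ factor n ⟧ w) ⌊ n <? q ⌋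
    sign-factor n n<N =
      subst (λ i → HasSign i ⌊ n <? q ⌋) (sym (⟦factor⟧ n n<N)) (HasSign-odd n q)

    sign-product : ∀ n → n ≤ N → HasSign (⟦ product n ⟧ w) (f 0 xor f (n ⊓ q))
    sign-product zero _ = subst₂ HasSign
      (sym (cong (ℤ._+ 0ℤ) (χ-constant false w))) (sym (xor-same (f 0))) (positive 0)
    sign-product (suc n) n<N with f n xor f (suc n) | ⊓-step f n q
    ... | false | step = subst (λ s → HasSign (⟦ product n ⟧ w) (f 0 xor s))
      (sym (trans step (xor-identityʳ (f (n ⊓ q)))))
      (sign-product n (ℕP.<⇒≤ n<N))
    ... | true  | step = subst₂ HasSign (sym (⟦⟧-⊛ (product n) (factor n) w))
      (trans (xor-assoc (f 0) (f (n ⊓ q)) ⌊ n <? q ⌋) (cong (f 0 xor_) (sym step)))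
      (HasSign-* (sign-product n (ℕP.<⇒≤ n<N)) (sign-factor n n<N))

    sign-interpolates : q ≤ N → HasSign (⟦ product N ⟧ w) (f 0 xor f q)
    sign-interpolates q≤N = subst (λ r → HasSign (⟦ product N ⟧ w) (f 0 xor f r))
      (ℕP.m≥n⇒m⊓n≡n q≤N) (sign-product N ℕP.≤-refl)

lemma4p4 : (m N k : ℕ) → 1 ≤ N → 1 ≤ k → (D : IntervalDist m N k) →
    Σ ℕ (λ N′ → N′ ≤ (2 * N) ^ (k ∸ 1) × Σ (ThresholdDist m N′) (λ D′ →
      (w : F2^ m) → ThrAccepts D′ w ⇔ IntAccepts D w))
lemma4p4 m N@(suc _) k (s≤s z≤n) _ D =
  length (product N) , size-bound , thresholdAtZero (product N) (f 0) , decides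
  where
    open IntervalDist D
    open IntervalPartition part

    ι : ℕ → Fin k
    ι q = idx (toℚ (level N q))

    f : ℕ → Bool
    f = label ∘ ι

    open SignInterpolation H b f

    size-bound : length (product N) ≤ (2 * N) ^ (k ∸ 1)
    size-bound = ℕP.≤-trans (length-product N ℕP.≤-refl) (ℕP.^-monoʳ-≤ (2 * N)
      (changes-≤ ι label (λ q → monotone _ _ (toℚ-mono-≤ (level-antitone N q))) N))

    decides : ∀ w → ThrAccepts (thresholdAtZero (product N) (f 0)) w ⇔ IntAccepts D w
    decides w with A-level H b w
    ... | q , q≤N , A≡level = subst (λ i → _ ⇔ label (idx (toℚ i)) ≡ true) (sym A≡level)
      (thresholdAtZero-accepts (product N) (f 0) w (f q) (sign-interpolates A≡level q≤N))
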